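{- Let $\mathcal{F}\subseteq\binom{[n]}{k}$ and suppose $\mathcal{F}$ is partitioned into subfamilies $\mathcal{F}_1,\ldots,\mathcal{F}_m$ such that for each $i\in[m]$, $\mathcal{F}_i$ is $(k,s)$-homogeneous (with some $k$-partition $(X^i_1,\ldots,X^i_k)$) with intersection pattern $\mathcal{J}_i$ that has rank $k-1$ and is of type 1. Let $H'$ be the simple graph on $[n]$ whose edges are all pairs $\{c(F),y\}$ with $F\in\mathcal{F}$ and $y\in F\setminus\{c(F)\}$. Then $$|\mathcal{F}|\leq\frac{e(H')}{k-1}\binom{n-2}{k-2}.$$
   Context: A family $\mathcal{G}\subseteq\binom{[n]}{k}$ is $k$-partite with $k$-partition $(X_1,\ldots,X_k)$ if $X_1,\ldots,X_k$ partition $[n]$ and $|F\cap X_j|=1$ for all $F\in\mathcal{G}$, $j\in[k]$. For $S\subseteq[n]$, $\Pi(S)=\{j: S\cap X_j\neq\emptyset\}$, and $\Pi(\mathcal{L})=\{\Pi(S):S\in\mathcal{L}\}$. For $F\in\mathcal{G}$, $\mathcal{I}(F,\mathcal{G})=\{F\cap F': F'\in\mathcal{G},F'\neq F\}$. An $s$-star with kernel $A$ is a family of sets $F_1,\ldots,F_s$ with $F_i\cap F_j=A$ for all $i<j$. $\mathcal{G}$ is $(k,s)$-homogeneous with intersection pattern $\mathcal{J}$ if it is $k$-partite with a $k$-partition $(X_1,\ldots,X_k)$, $\mathcal{J}$ is a family of proper subsets of $[k]$ closed under intersection with $\Pi(\mathcal{I}(F,\mathcal{G}))=\mathcal{J}$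 for all $F\in\mathcal{G}$, and for every $F\in\mathcal{G}$ and $A\in\mathcal{I}(F,\mathcal{G})$ there is an $s$-star in $\mathcal{G}$ containing $F$ with kernel $A$. The rank of $\mathcal{L}\subseteq 2^{[k]}$ is $r(\mathcal{L})=\min\{|D|: D\subseteq[k],\ \text{no } B\in\mathcal{L}\text{ with } D\subseteq B\}$. $\mathcal{L}$ of rank $k-1$ is of type 1 if there is a (necessarily unique) $x\in[k]$ with $[k]\setminus\{x\}\notin\mathcal{L}$ but $[k]\setminus\{y\}\in\mathcal{L}$ for all $y\neq x$. Central element: for $F\in\mathcal{F}_p$, let $x_p\in[k]$ be the element with $[k]\setminus\{x_p\}\notin\mathcal{J}_p$; then $c(F)$ is the unique vertex of $F\cap X^p_{x_p}$. -}

module Defs where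

open import Data.Nat using (ℕ; _<?_) renaming (_≟_ to _≟ℕ_)
open import Data.Bool using (Bool; true; false)
open import Data.Fin using (Fin; toℕ; _≟_)
open import Data.Fin.Subset using (Subset; _∈_; _∉_; _⊆_; _∩_; ⊤; ∁; ⁅_⁆; ∣_∣)
open import Data.Fin.Subset.Properties using (_∈?_)
open import Data.Fin.Properties using (any?)
open import Data.Vec using (tabulate)
open import Data.List using (List; length; filter; cartesianProduct; allFin)
open import Data.List.Relation.Unary.Any using (Any) renaming (any? to anyL?)
open import Data.List.Membership.Propositional renaming (_∈_ to _∈ₗ_)
open import Data.Product using (Σ; ∃; ∃-syntax; _×_; _,_; proj₁; proj₂)
open import Data.Sum using (_⊎_)
open import Function using (Injective; _∘_)
open import Relation.Nullary using (¬_; Dec; does; ¬?)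
open import Relation.Nullary.Decidable using (_×-dec_; _⊎-dec_)
open import Relation.Binary.PropositionalEquality using (_≡_; _≢_)

Family : ℕ → Set
Family n = List (Subset n)

-- A k-partition (X_1,...,X_k) of [n] is encoded by the map part : Fin n → Fin k
-- sending a vertex to the index of its block.
Block : ∀ {n k} → (Fin n → Fin k) → Fin k → Subset n
Block part j = tabulate (λ v → does (part v ≟ j))

Π : ∀ {n k} → (Fin n → Fin k) → Subset n → Subset k
Π {n} part S = tabulate (λ j → does (any? (λ v → (v ∈? S) ×-dec (part v ≟ j))))

KPartite : ∀ {n k} → (Fin n → Fin k) → Family n → Set
KPartite part G = ∀ F → F ∈ₗ G → ∀ j → ∣ F ∩ Block part j ∣ ≡ 1

StarIn : ∀ {n} → ℕ → Family n → Subset n → Subset n → Set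
StarIn {n} s G F A =
  Σ (Fin s → Subset n) λ st →
    Injective _≡_ _≡_ st
    × (∀ i → st i ∈ₗ G)
    × (∃[ i ] st i ≡ F)
    × (∀ i j → i ≢ j → st i ∩ st j ≡ A)

Homogeneous : ∀ {n} (k s : ℕ) → (Fin n → Fin k) → (Subset k → Set) → Family n → Set
Homogeneous {n} k s part J G =
  KPartite part G
  × (∀ B → J B → B ≢ ⊤)
  × (∀ B C → J B → J C → J (B ∩ C))
  × (∀ F → F ∈ₗ G → ∀ B →
       (J B → ∃[ F' ] (F' ∈ₗ G × F' ≢ F × Π part (F ∩ F') ≡ B))
       × (∃[ F' ] (F' ∈ₗ G × F' ≢ F × Π part (F ∩ F') ≡ B) → J B))
  × (∀ F F' → F ∈ₗ G → F' ∈ₗ G → F' ≢ F → StarIn s G F (F ∩ F'))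

Uncovered : ∀ {k} → (Subset k → Set) → Subset k → Set
Uncovered L D = ¬ (∃[ B ] (L B × D ⊆ B))

HasRank : ∀ {k} → (Subset k → Set) → ℕ → Set
HasRank {k} L r =
  (∃[ D ] (Uncovered L D × ∣ D ∣ ≡ r))
  × (∀ D → Uncovered L D → r Data.Nat.≤ ∣ D ∣)

Type1With : ∀ {k} → (Subset k → Set) → Fin k → Set
Type1With L x = ¬ L (∁ ⁅ x ⁆) × (∀ y → y ≢ x → L (∁ ⁅ y ⁆))

Type1 : ∀ {k} → (Subset k → Set) → Set
Type1 {k} L = ∃[ x ] Type1With {k} L x

-- Directed adjacency in H': u = c(F) and w ∈ F \ {c(F)} for some F in some F_p.
-- c(F) is the (unique, by k-partiteness) vertex c ∈ F with part_p c = x_p.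
Adj : ∀ {n k m} → (Fin m → Family n) → (Fin m → Fin n → Fin k) → (Fin m → Fin k)
    → Fin n → Fin n → Set
Adj {n} Fs part x u w =
  ∃[ p ] Any (λ F → ∃[ c ] (c ∈ F × part p c ≡ x p × u ≡ c × w ∈ F × w ≢ c)) (Fs p)

Adj? : ∀ {n k m} (Fs : Fin m → Family n) (part : Fin m → Fin n → Fin k) (x : Fin m → Fin k)
     → ∀ u w → Dec (Adj Fs part x u w)
Adj? Fs part x u w =
  any? (λ p → anyL? (λ F → any? (λ c →
     (c ∈? F) ×-dec ((part p c ≟ x p) ×-dec ((u ≟ c) ×-dec ((w ∈? F) ×-dec ¬? (w ≟ c))))))
     (Fs p))

edgeCount : ∀ {n k m} → (Fin m → Family n) → (Fin m → Fin n → Fin k) → (Fin m → Fin k) → ℕ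
edgeCount {n} Fs part x =
  length (filter (λ e → (toℕ (proj₁ e) <? toℕ (proj₂ e))
                        ×-dec (Adj? Fs part x (proj₁ e) (proj₂ e)
                               ⊎-dec Adj? Fs part x (proj₂ e) (proj₁ e)))
                 (cartesianProduct (allFin n) (allFin n)))

module Submission where

-- Lemma 4.3 by double counting the edges of H' spanned by the members of F.
--
-- A member A of F lies in some F_p, which is k-partite, so A has a vertex c in the
-- block X^p_{x_p}; by the definition of H' this central vertex is adjacent to every other vertex
-- of A, hence A spans at least |A| - 1 = k - 1 edges of H' (star-bound).
--
-- Distinct k-sets through two fixed distinct points number at most C(n-2, k-2)
-- (pair-bound, a case of extensions-bound).  So when the edges spanned by the members of F are
-- summed over F, every edge of H' is counted at most C(n-2, k-2) times (double-count).

open import Defs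

open import Data.Bool using (Bool; true; false; if_then_else_) renaming (_≟_ to _≟ᵇ_)
open import Data.Nat using (ℕ; zero; suc; _+_; _*_; _∸_; _≤_; _<_; _<?_; z≤n; s≤s)
open import Data.Nat.Properties
  using (+-*-semiring; *-zeroʳ; *-suc; +-identityʳ; +-mono-≤; ≤-refl; +-suc; suc-injective; ≤-reflexive; <-irrefl; n<1+n; m+[n∸m]≡n; *-identityˡ; m≤m+n; m≤n+m; <-cmp; <⇒≢; ∸-monoˡ-≤; +-monoʳ-≤; module ≤-Reasoning)
open import Data.Fin using (Fin; zero; suc; toℕ; _≟_)
open import Data.Fin.Subset using (Subset; ∣_∣; _⊆_; ⁅_⁆; _∪_; _∩_; ∁) renaming (_∈_ to _∈ˢ_)
open import Data.Fin.Subset.Properties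
  using (_∈?_; drop-there; ∪-identityˡ; ∪-identityʳ; ∣⁅x⁆∣≡1; p⊆q⇒∣p∣≤∣q∣; ∣∁p∣≡n∸∣p∣; x∈p∪q⁻; x∈p∩q⁻; x∈⁅y⁆⇒x≡y)
open import Data.Vec using ([]; _∷_; here; there)
open import Data.Vec.Properties using ([]=⇒lookup; lookup∘tabulate)
open import Data.List using (List; []; _∷_; _++_; length; filter; lookup; tabulate; map; cartesianProduct; allFin)
open import Data.List.Properties using (filter-++; length-++; map-tabulate)
open import Data.List.Relation.Unary.Unique.Propositional using (Unique)
open import Data.List.Relation.Unary.AllPairs using ([]; _∷_)
open import Data.List.Relation.Unary.All as All using ()
open import Data.List.Relation.Unary.Any as Any using (here; there)
open import Data.List.Membership.Propositional using (_∈_)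
open import Data.List.Membership.Propositional.Properties using (∈-filter⁻; ∈-lookup)
open import Data.List.Relation.Unary.Unique.Propositional.Properties using (filter⁺)
open import Data.Nat.Combinatorics using (_C_; nCk+nC[k+1]≡[n+1]C[k+1])
open import Data.Product using (_×_; _,_; proj₁; proj₂; ∃-syntax)
open import Data.Sum using (_⊎_; inj₁; inj₂)
open import Relation.Nullary.Decidable using (_×-dec_; _⊎-dec_)
open import Relation.Binary.Definitions using (tri<; tri≈; tri>)
open import Data.Fin.Properties using (toℕ-injective)
open import Data.Empty using (⊥-elim)
open import Function using (_∘_; id)
open import Relation.Nullary using (Dec; yes; no; does; ¬_)
open import Relation.Unary using (Pred; Decidable)
open import Relation.Binary.PropositionalEquality using (_≡_; _≢_; refl; sym; trans; cong; cong₂; subst; subst₂; module ≡-Reasoning)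
open import Algebra.Properties.Semiring.Sum +-*-semiring
  using (sum-syntax; ∑-comm; ∑-distrib-+; sum-cong-≗; sum-replicate-zero; *-distribˡ-sum; *-distribʳ-sum)

𝟙 : ∀ {p} {P : Set p} → Dec P → ℕ
𝟙 d = if does d then 1 else 0

𝟙-yes : ∀ {p} {P : Set p} (d : Dec P) → P → 𝟙 d ≡ 1
𝟙-yes (yes _) _ = refl
𝟙-yes (no ¬p) p = ⊥-elim (¬p p)

𝟙-no : ∀ {p} {P : Set p} (d : Dec P) → ¬ P → 𝟙 d ≡ 0
𝟙-no (yes p) ¬p = ⊥-elim (¬p p)
𝟙-no (no _) _ = refl

𝟙-≤ : ∀ {p} {P : Set p} (d : Dec P) {m} → (P → 1 ≤ m) → 𝟙 d ≤ m
𝟙-≤ (yes p) 1≤m = 1≤m p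
𝟙-≤ (no _) _ = z≤n

𝟙-*-monoʳ : ∀ {p} {P : Set p} (d : Dec P) {m o} → (P → m ≤ o) → 𝟙 d * m ≤ 𝟙 d * o
𝟙-*-monoʳ (yes p) m≤o = +-mono-≤ (m≤o p) z≤n
𝟙-*-monoʳ (no _) _ = z≤n

∑-mono : ∀ {n} {f g : Fin n → ℕ} → (∀ i → f i ≤ g i) → (∑[ i < n ] f i) ≤ (∑[ i < n ] g i)
∑-mono {zero} f≤g = z≤n
∑-mono {suc n} f≤g = +-mono-≤ (f≤g zero) (∑-mono (f≤g ∘ suc))

∑-const : ∀ n (c : ℕ) → (∑[ i < n ] c) ≡ c * n
∑-const zero c = sym (*-zeroʳ c)
∑-const (suc n) c = trans (cong (c +_) (∑-const n c)) (sym (*-suc c n))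

∑-delta : ∀ {n} (c : Fin n) (f : Fin n → ℕ) → (∑[ u < n ] (𝟙 (u ≟ c) * f u)) ≡ f c
∑-delta {suc n} zero f = trans (cong₂ _+_ (+-identityʳ (f zero)) (sum-replicate-zero n)) (+-identityʳ (f zero))
∑-delta {suc n} (suc c) f = ∑-delta c (f ∘ suc)

∑-point : ∀ {n} (c : Fin n) → (∑[ u < n ] 𝟙 (u ≟ c)) ≡ 1
∑-point {suc n} zero = cong suc (sum-replicate-zero n)
∑-point {suc n} (suc c) = ∑-point c

∑-cross : ∀ {n} (f : Fin n → Fin n → ℕ) (c : Fin n) → f c c ≡ 0
  → (∑[ w < n ] f c w) + (∑[ u < n ] f u c) ≤ (∑[ u < n ] ∑[ w < n ] f u w)
∑-cross {n} f c fcc≡0 = begin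
    (∑[ w < n ] f c w) + (∑[ u < n ] f u c)
  ≡⟨ cong₂ _+_ row column ⟨
    (∑[ u < n ] ∑[ w < n ] (𝟙 (u ≟ c) * f u w)) + (∑[ u < n ] ∑[ w < n ] (𝟙 (w ≟ c) * f u w))
  ≡⟨ trans (sum-cong-≗ (λ u → ∑-distrib-+ (λ w → 𝟙 (u ≟ c) * f u w) (λ w → 𝟙 (w ≟ c) * f u w)))
           (∑-distrib-+ (λ u → ∑[ w < n ] (𝟙 (u ≟ c) * f u w)) (λ u → ∑[ w < n ] (𝟙 (w ≟ c) * f u w))) ⟨
    (∑[ u < n ] ∑[ w < n ] (𝟙 (u ≟ c) * f u w + 𝟙 (w ≟ c) * f u w))
  ≤⟨ ∑-mono (λ u → ∑-mono (λ w → cross-entry u w)) ⟩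
    (∑[ u < n ] ∑[ w < n ] f u w)
  ∎
  where
  open ≤-Reasoning
  row : (∑[ u < n ] ∑[ w < n ] (𝟙 (u ≟ c) * f u w)) ≡ (∑[ w < n ] f c w)
  row = trans (∑-comm (λ u w → 𝟙 (u ≟ c) * f u w)) (sum-cong-≗ (λ w → ∑-delta c (λ u → f u w)))
  column : (∑[ u < n ] ∑[ w < n ] (𝟙 (w ≟ c) * f u w)) ≡ (∑[ u < n ] f u c)
  column = sum-cong-≗ (λ u → ∑-delta c (f u))
  cross-entry : ∀ u w → 𝟙 (u ≟ c) * f u w + 𝟙 (w ≟ c) * f u w ≤ f u w
  cross-entry u w with u ≟ c | w ≟ c
  ... | yes refl | yes refl rewrite fcc≡0 = z≤n
  ... | yes _ | no _ = ≤-reflexive (trans (+-identityʳ _) (*-identityˡ _))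
  ... | no _ | yes _ = ≤-reflexive (*-identityˡ _)
  ... | no _ | no _ = z≤n

module _ {a p} {A : Set a} {P : Pred A p} (P? : Decidable P) where

  count-lookup : (xs : List A) → length (filter P? xs) ≡ (∑[ i < length xs ] 𝟙 (P? (lookup xs i)))
  count-lookup [] = refl
  count-lookup (x ∷ xs) with P? x
  ... | yes _ = cong suc (count-lookup xs)
  ... | no _ = count-lookup xs

  count-tabulate : ∀ {n} (g : Fin n → A) → length (filter P? (tabulate g)) ≡ (∑[ i < n ] 𝟙 (P? (g i)))
  count-tabulate {zero} g = refl
  count-tabulate {suc n} g with P? (g zero)
  ... | yes _ = cong suc (count-tabulate (g ∘ suc))
  ... | no _ = count-tabulate (g ∘ suc)

  count-++ : (xs ys : List A) → length (filter P? (xs ++ ys)) ≡ length (filter P? xs) + length (filter P? ys)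
  count-++ xs ys = trans (cong length (filter-++ P? xs ys)) (length-++ (filter P? xs))

module _ {a b p} {A : Set a} {B : Set b} {P : Pred (A × B) p} (P? : Decidable P) where

  count-cartesian : ∀ {m} (g : Fin m → A) (ys : List B) →
    length (filter P? (cartesianProduct (tabulate g) ys)) ≡ (∑[ i < m ] length (filter P? (map (g i ,_) ys)))
  count-cartesian {zero} g ys = refl
  count-cartesian {suc m} g ys =
    trans (count-++ P? (map (g zero ,_) ys) _) (cong (length (filter P? (map (g zero ,_) ys)) +_) (count-cartesian (g ∘ suc) ys))

count-allPairs : ∀ {n p} {P : Pred (Fin n × Fin n) p} (P? : Decidable P) →
  length (filter P? (cartesianProduct (allFin n) (allFin n))) ≡ (∑[ u < n ] ∑[ w < n ] 𝟙 (P? (u , w)))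
count-allPairs {n} P? = trans (count-cartesian P? id (allFin n)) (sum-cong-≗ row)
  where
  row : ∀ u → length (filter P? (map (u ,_) (allFin n))) ≡ (∑[ w < n ] 𝟙 (P? (u , w)))
  row u = trans (cong (length ∘ filter P?) (map-tabulate id (u ,_))) (count-tabulate P? (u ,_))

size-as-sum : ∀ {n} (A : Subset n) → ∣ A ∣ ≡ (∑[ w < n ] 𝟙 (w ∈? A))
size-as-sum [] = refl
size-as-sum (true ∷ A) = cong suc (size-as-sum A)
size-as-sum (false ∷ A) = size-as-sum A

withHead : ∀ {n} → Bool → List (Subset (suc n)) → List (Subset n)
withHead b [] = []
withHead b ((c ∷ A) ∷ L) = if does (b ≟ᵇ c) then A ∷ withHead b L else withHead b L

withHead-∈ : ∀ {n} b (L : List (Subset (suc n))) {A} → A ∈ withHead b L → (b ∷ A) ∈ L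
withHead-∈ b ((c ∷ A) ∷ L) A∈ with b ≟ᵇ c
... | yes refl with A∈
...   | here refl = here refl
...   | there A∈′ = there (withHead-∈ b L A∈′)
withHead-∈ b ((c ∷ A) ∷ L) A∈ | no _ = there (withHead-∈ b L A∈)

withHead-unique : ∀ {n} b (L : List (Subset (suc n))) → Unique L → Unique (withHead b L)
withHead-unique b [] [] = []
withHead-unique b ((c ∷ A) ∷ L) (A∉L ∷ uL) with b ≟ᵇ c
... | yes refl = All.tabulate (λ B∈ A≡B → All.lookup A∉L (withHead-∈ b L B∈) (cong (b ∷_) A≡B)) ∷ withHead-unique b L uL
... | no _ = withHead-unique b L uL

length-withHead : ∀ {n} (L : List (Subset (suc n))) → length L ≡ length (withHead true L) + length (withHead false L)
length-withHead [] = refl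
length-withHead ((true ∷ A) ∷ L) = cong suc (length-withHead L)
length-withHead ((false ∷ A) ∷ L) = trans (cong suc (length-withHead L)) (sym (+-suc _ _))

withHead-⊇ : ∀ {n} b (L : List (Subset (suc n))) {c M} → (∀ {A} → A ∈ L → (c ∷ M) ⊆ A)
  → ∀ {A} → A ∈ withHead b L → M ⊆ A
withHead-⊇ b L M⊆ A∈ x∈ = drop-there (M⊆ (withHead-∈ b L A∈) (there x∈))

length-no-members : ∀ {a} {A : Set a} (xs : List A) → (∀ {x} → ¬ x ∈ xs) → length xs ≡ 0
length-no-members [] _ = refl
length-no-members (x ∷ xs) ∉xs = ⊥-elim (∉xs (here refl))

-- A duplicate-free list of supersets A of M with |A| = |M| + j has at most C(|∁M|, j)
-- members: each member is M together with a j-subset of the complement of M.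
extensions-bound : ∀ {n} (M : Subset n) (j : ℕ) (L : List (Subset n)) → Unique L
  → (∀ {A} → A ∈ L → M ⊆ A) → (∀ {A} → A ∈ L → ∣ A ∣ ≡ ∣ M ∣ + j) → length L ≤ ∣ ∁ M ∣ C j
extensions-bound [] j [] _ _ _ = z≤n
extensions-bound [] j ([] ∷ []) _ _ size with size (here refl)
... | refl = ≤-refl
extensions-bound [] j ([] ∷ [] ∷ L) (A∉L ∷ _) _ _ = ⊥-elim (All.head A∉L refl)
extensions-bound (true ∷ M) j L uL M⊆ size = begin
    length L
  ≡⟨ length-withHead L ⟩
    length (withHead true L) + length (withHead false L)
  ≡⟨ cong (length (withHead true L) +_) (length-no-members (withHead false L) (λ A∈ → zero∉ (M⊆ (withHead-∈ false L A∈) here))) ⟩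
    length (withHead true L) + 0
  ≡⟨ +-identityʳ _ ⟩
    length (withHead true L)
  ≤⟨ extensions-bound M j (withHead true L) (withHead-unique true L uL)
       (withHead-⊇ true L M⊆)
       (λ A∈ → suc-injective (size (withHead-∈ true L A∈))) ⟩
    ∣ ∁ M ∣ C j
  ∎
  where
  open ≤-Reasoning
  -- every member contains the first point, so none has first coordinate false
  zero∉ : ∀ {n} {A : Subset n} → ¬ zero ∈ˢ (false ∷ A)
  zero∉ ()
extensions-bound (false ∷ M) zero L uL M⊆ size = begin
    length L
  ≡⟨ length-withHead L ⟩
    length (withHead true L) + length (withHead false L)
  ≡⟨ cong (_+ length (withHead false L)) (length-no-members (withHead true L) too-large) ⟩
    length (withHead false L)
  ≤⟨ extensions-bound M zero (withHead false L) (withHead-unique false L uL)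
       (withHead-⊇ false L M⊆)
       (λ A∈ → size (withHead-∈ false L A∈)) ⟩
    ∣ ∁ M ∣ C zero
  ∎
  where
  open ≤-Reasoning
  -- a member containing the first point would have more than |M| elements
  too-large : ∀ {A} → ¬ A ∈ withHead true L
  too-large {A} A∈ = <-irrefl refl (begin-strict
      ∣ M ∣ ≤⟨ p⊆q⇒∣p∣≤∣q∣ (withHead-⊇ true L M⊆ A∈) ⟩
      ∣ A ∣ <⟨ n<1+n ∣ A ∣ ⟩
      suc ∣ A ∣ ≡⟨ size (withHead-∈ true L A∈) ⟩
      ∣ M ∣ + 0 ≡⟨ +-identityʳ ∣ M ∣ ⟩
      ∣ M ∣ ∎)
extensions-bound (false ∷ M) (suc j) L uL M⊆ size = begin
    length L
  ≡⟨ length-withHead L ⟩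
    length (withHead true L) + length (withHead false L)
  ≤⟨ +-mono-≤
       (extensions-bound M j (withHead true L) (withHead-unique true L uL)
         (withHead-⊇ true L M⊆)
         (λ A∈ → suc-injective (trans (size (withHead-∈ true L A∈)) (+-suc ∣ M ∣ j))))
       (extensions-bound M (suc j) (withHead false L) (withHead-unique false L uL)
         (withHead-⊇ false L M⊆)
         (λ A∈ → size (withHead-∈ false L A∈))) ⟩
    ∣ ∁ M ∣ C j + ∣ ∁ M ∣ C suc j
  ≡⟨ nCk+nC[k+1]≡[n+1]C[k+1] ∣ ∁ M ∣ j ⟩
    suc ∣ ∁ M ∣ C suc j
  ∎
  where open ≤-Reasoning

pair-size : ∀ {n} {a b : Fin n} → a ≢ b → ∣ ⁅ a ⁆ ∪ ⁅ b ⁆ ∣ ≡ 2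
pair-size {a = zero} {zero} a≢b = ⊥-elim (a≢b refl)
pair-size {a = zero} {suc b} _ = cong suc (trans (cong ∣_∣ (∪-identityˡ ⁅ b ⁆)) (∣⁅x⁆∣≡1 b))
pair-size {a = suc a} {zero} _ = cong suc (trans (cong ∣_∣ (∪-identityʳ ⁅ a ⁆)) (∣⁅x⁆∣≡1 a))
pair-size {a = suc a} {suc b} a≢b = pair-size (a≢b ∘ cong suc)

pair-bound : ∀ {n} k {a b : Fin n} → a ≢ b → (L : List (Subset n)) → Unique L
  → (∀ {A} → A ∈ L → a ∈ˢ A × b ∈ˢ A) → (∀ {A} → A ∈ L → ∣ A ∣ ≡ k) → length L ≤ (n ∸ 2) C (k ∸ 2)
pair-bound {n} k {a} {b} a≢b L uL ab∈ size =
  subst (λ r → length L ≤ r C (k ∸ 2)) complement-size (extensions-bound M (k ∸ 2) L uL M⊆ size-M)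
  where
  M : Subset n
  M = ⁅ a ⁆ ∪ ⁅ b ⁆
  M⊆ : ∀ {A} → A ∈ L → M ⊆ A
  M⊆ A∈ x∈ with x∈p∪q⁻ ⁅ a ⁆ ⁅ b ⁆ x∈ | ab∈ A∈
  ... | inj₁ x∈a | a∈ , _ = subst (_∈ˢ _) (sym (x∈⁅y⁆⇒x≡y a x∈a)) a∈
  ... | inj₂ x∈b | _ , b∈ = subst (_∈ˢ _) (sym (x∈⁅y⁆⇒x≡y b x∈b)) b∈
  complement-size : ∣ ∁ M ∣ ≡ n ∸ 2
  complement-size = trans (∣∁p∣≡n∸∣p∣ M) (cong (n ∸_) (pair-size a≢b))
  size-M : ∀ {A} → A ∈ L → ∣ A ∣ ≡ ∣ M ∣ + (k ∸ 2)
  size-M {A} A∈ = begin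
      ∣ A ∣         ≡⟨ size A∈ ⟩
      k             ≡⟨ m+[n∸m]≡n 2≤k ⟨
      2 + (k ∸ 2)   ≡⟨ cong (_+ (k ∸ 2)) (pair-size a≢b) ⟨
      ∣ M ∣ + (k ∸ 2) ∎
    where
    open ≡-Reasoning
    2≤k : 2 ≤ k
    2≤k = subst₂ _≤_ (pair-size a≢b) (size A∈) (p⊆q⇒∣p∣≤∣q∣ (M⊆ A∈))

-- The simple graph on [n] underlying a decidable directed adjacency relation Arc;
-- an edge {u, w} is recorded once, as the ordered pair with toℕ u < toℕ w.
module SimpleGraph {n : ℕ} {Arc : Fin n → Fin n → Set} (Arc? : ∀ u w → Dec (Arc u w)) where

  edge? : ∀ u w → Dec (toℕ u < toℕ w × (Arc u w ⊎ Arc w u))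
  edge? u w = (toℕ u <? toℕ w) ×-dec (Arc? u w ⊎-dec Arc? w u)

  inside? : (A : Subset n) → ∀ u w → Dec (u ∈ˢ A × w ∈ˢ A)
  inside? A u w = (u ∈? A) ×-dec (w ∈? A)

  edges : ℕ
  edges = ∑[ u < n ] ∑[ w < n ] 𝟙 (edge? u w)

  edgesIn : Subset n → ℕ
  edgesIn A = ∑[ u < n ] ∑[ w < n ] (𝟙 (edge? u w) * 𝟙 (inside? A u w))

  -- A set A containing a vertex c adjacent to all other vertices of A spans at least |A| - 1 edges:
  -- every w ∈ A other than c gives the edge {c, w}.
  star-bound : ∀ {A c} → c ∈ˢ A → (∀ {w} → w ∈ˢ A → w ≢ c → Arc c w) → ∣ A ∣ ≤ 1 + edgesIn A
  star-bound {A} {c} c∈A hub = begin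
      ∣ A ∣
    ≡⟨ size-as-sum A ⟩
      (∑[ w < n ] 𝟙 (w ∈? A))
    ≤⟨ ∑-mono spoke ⟩
      (∑[ w < n ] (𝟙 (w ≟ c) + (e c w + e w c)))
    ≡⟨ ∑-distrib-+ (λ w → 𝟙 (w ≟ c)) (λ w → e c w + e w c) ⟩
      (∑[ w < n ] 𝟙 (w ≟ c)) + (∑[ w < n ] (e c w + e w c))
    ≡⟨ cong₂ _+_ (∑-point c) (∑-distrib-+ (e c) (λ w → e w c)) ⟩
      1 + ((∑[ w < n ] e c w) + (∑[ w < n ] e w c))
    ≤⟨ +-monoʳ-≤ 1 (∑-cross e c (cong (_* 𝟙 (inside? A c c)) (𝟙-no (edge? c c) (<-irrefl refl ∘ proj₁)))) ⟩
      1 + edgesIn A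
    ∎
    where
    open ≤-Reasoning
    e : Fin n → Fin n → ℕ
    e u w = 𝟙 (edge? u w) * 𝟙 (inside? A u w)
    edge-inside : ∀ {u w} → toℕ u < toℕ w → Arc u w ⊎ Arc w u → u ∈ˢ A → w ∈ˢ A → e u w ≡ 1
    edge-inside u<w adj u∈A w∈A = cong₂ _*_ (𝟙-yes (edge? _ _) (u<w , adj)) (𝟙-yes (inside? A _ _) (u∈A , w∈A))
    spoke : ∀ w → 𝟙 (w ∈? A) ≤ 𝟙 (w ≟ c) + (e c w + e w c)
    spoke w = 𝟙-≤ (w ∈? A) member
      where
      member : w ∈ˢ A → 1 ≤ 𝟙 (w ≟ c) + (e c w + e w c)
      member w∈A with w ≟ c
      ... | yes _ = s≤s z≤n
      ... | no w≢c with <-cmp (toℕ c) (toℕ w)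
      ...   | tri< c<w _ _ = subst (1 ≤_) (cong (_+ e w c) (sym (edge-inside c<w (inj₁ (hub w∈A w≢c)) c∈A w∈A))) (m≤m+n 1 _)
      ...   | tri≈ _ c≡w _ = ⊥-elim (w≢c (toℕ-injective (sym c≡w)))
      ...   | tri> _ _ w<c = subst (1 ≤_) (cong (e c w +_) (sym (edge-inside w<c (inj₂ (hub w∈A w≢c)) w∈A c∈A))) (m≤n+m 1 _)

  -- Double counting: an edge {u, w} lies in at most C(n-2, k-2) of a family of distinct
  -- k-sets, so the edges spanned by the members, summed over the family, number at most
  -- e · C(n-2, k-2).
  double-count : ∀ k (L : List (Subset n)) → Unique L → (∀ {A} → A ∈ L → ∣ A ∣ ≡ k)
    → (∑[ i < length L ] edgesIn (lookup L i)) ≤ edges * ((n ∸ 2) C (k ∸ 2))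
  double-count k L uL size = begin
      (∑[ i < length L ] ∑[ u < n ] ∑[ w < n ] term i u w)
    ≡⟨ ∑-comm (λ i u → ∑[ w < n ] term i u w) ⟩
      (∑[ u < n ] ∑[ i < length L ] ∑[ w < n ] term i u w)
    ≡⟨ sum-cong-≗ (λ u → ∑-comm (λ i w → term i u w)) ⟩
      (∑[ u < n ] ∑[ w < n ] ∑[ i < length L ] term i u w)
    ≡⟨ sum-cong-≗ (λ u → sum-cong-≗ (λ w → trans (cong (𝟙 (edge? u w) *_) (count-lookup (λ A → inside? A u w) L))
                                                (*-distribˡ-sum (𝟙 (edge? u w)) (λ i → 𝟙 (inside? (lookup L i) u w))))) ⟨
      (∑[ u < n ] ∑[ w < n ] (𝟙 (edge? u w) * length (filter (λ A → inside? A u w) L)))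
    ≤⟨ ∑-mono (λ u → ∑-mono (λ w → through-edge u w)) ⟩
      (∑[ u < n ] ∑[ w < n ] (𝟙 (edge? u w) * bound))
    ≡⟨ trans (*-distribʳ-sum bound (λ u → ∑[ w < n ] 𝟙 (edge? u w))) (sum-cong-≗ (λ u → *-distribʳ-sum bound (λ w → 𝟙 (edge? u w)))) ⟨
      edges * bound
    ∎
    where
    open ≤-Reasoning
    bound : ℕ
    bound = (n ∸ 2) C (k ∸ 2)
    term : Fin (length L) → Fin n → Fin n → ℕ
    term i u w = 𝟙 (edge? u w) * 𝟙 (inside? (lookup L i) u w)
    through-edge : ∀ u w → 𝟙 (edge? u w) * length (filter (λ A → inside? A u w) L) ≤ 𝟙 (edge? u w) * bound
    through-edge u w = 𝟙-*-monoʳ (edge? u w) λ (u<w , _) → pair-bound k (<⇒≢ u<w ∘ cong toℕ) (filter P? L) (filter⁺ P? uL)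
                                          (proj₂ ∘ ∈-filter⁻ P? {xs = L}) (size ∘ proj₁ ∘ ∈-filter⁻ P? {xs = L})
      where
      P? = λ A → inside? A u w

block-member : ∀ {n k} (part : Fin n → Fin k) {j c} → c ∈ˢ Block part j → part c ≡ j
block-member part {j} {c} c∈ with part c ≟ j | trans (sym (lookup∘tabulate (λ v → does (part v ≟ j)) c)) ([]=⇒lookup c∈)
... | yes pc≡j | _ = pc≡j
... | no _ | ()

member-of-nonempty : ∀ {n} (A : Subset n) {r} → ∣ A ∣ ≡ suc r → ∃[ c ] c ∈ˢ A
member-of-nonempty (true ∷ A) _ = zero , here
member-of-nonempty (false ∷ A) size with member-of-nonempty A size
... | c , c∈A = suc c , there c∈A

meets-block : ∀ {n k} {part : Fin n → Fin k} {G : Family n} → KPartite part G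
  → ∀ {F} → F ∈ G → ∀ j → ∃[ c ] (c ∈ˢ F × part c ≡ j)
meets-block {part = part} kpartite {F} F∈G j with member-of-nonempty (F ∩ Block part j) (kpartite F F∈G j)
... | c , c∈ = c , x∈p∩q⁻ F _ c∈ .proj₁ , block-member part (x∈p∩q⁻ F _ c∈ .proj₂)

central-adjacent : ∀ {n k m} (Fs : Fin m → Family n) (part : Fin m → Fin n → Fin k) (x : Fin m → Fin k)
  → ∀ {p A c w} → A ∈ Fs p → c ∈ˢ A → part p c ≡ x p → w ∈ˢ A → w ≢ c → Adj Fs part x c w
central-adjacent Fs part x {p} A∈Fp c∈A central w∈A w≢c =
  p , Any.map (λ { refl → _ , c∈A , central , refl , w∈A , w≢c }) A∈Fp

lemma4p3 : (n k s m : ℕ) → 2 ≤ k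
    → (F : List (Subset n)) → Unique F
    → (∀ A → A ∈ F → ∣ A ∣ ≡ k)
    → (Fs : Fin m → List (Subset n))
    → (∀ A → A ∈ F → ∃[ p ] (A ∈ Fs p))
    → (∀ p A → A ∈ Fs p → A ∈ F)
    → (∀ p q A → A ∈ Fs p → A ∈ Fs q → p ≡ q)
    → (part : Fin m → Fin n → Fin k)
    → (J : Fin m → Subset k → Set)
    → (∀ p → Homogeneous k s (part p) (J p) (Fs p))
    → (∀ p → HasRank (J p) (k ∸ 1))
    → (x : Fin m → Fin k)
    → (∀ p → Type1With (J p) (x p))
    → (k ∸ 1) * length F ≤ edgeCount Fs part x * ((n ∸ 2) C (k ∸ 2))
lemma4p3 n k _ _ _ F unique size Fs cover _ _ part _ homogeneous _ x _ = begin
    (k ∸ 1) * length F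
  ≡⟨ ∑-const (length F) (k ∸ 1) ⟨
    (∑[ i < length F ] (k ∸ 1))
  ≤⟨ ∑-mono (λ i → spans (∈-lookup i)) ⟩
    (∑[ i < length F ] edgesIn (lookup F i))
  ≤⟨ double-count k F unique (size _) ⟩
    edges * ((n ∸ 2) C (k ∸ 2))
  ≡⟨ cong (_* ((n ∸ 2) C (k ∸ 2))) (count-allPairs (λ e → edge? (proj₁ e) (proj₂ e))) ⟨
    edgeCount Fs part x * ((n ∸ 2) C (k ∸ 2))
  ∎
  where
  open ≤-Reasoning
  open SimpleGraph (Adj? Fs part x)
  spans : ∀ {A} → A ∈ F → k ∸ 1 ≤ edgesIn A
  spans {A} A∈F with cover A A∈F
  ... | p , A∈Fp with meets-block (proj₁ (homogeneous p)) A∈Fp (x p)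
  ...   | c , c∈A , central =
    subst (λ r → r ∸ 1 ≤ edgesIn A) (size A A∈F)
      (∸-monoˡ-≤ 1 (star-bound c∈A (central-adjacent Fs part x A∈Fp c∈A central)))
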